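{- Let $n\ge 2$ and let $-1\le i<j$ be integers. Then for all $b\in\mathcal{N}_i$ and $b'\in\mathcal{N}_j$, the bracket $[b,b']$ lies in $\mathbb{Z}\mathcal{N}_{j-1}$ (the $\mathbb{Z}$-span of $\mathcal{N}_{j-1}$; in particular it is either $0$ or a nonzero integer multiple of an element of $\mathcal{N}_{j-1}$).
   Context: Let $n\ge 2$ be an integer. A partition is a sequence $\Lambda=(\lambda_t)_{t\ge 1}$ of non-negative integers with finite support; $\mathrm{wt}(\Lambda)=\sum_t t\lambda_t$; $x^\Lambda=\prod_t x_t^{\lambda_t}$ (monomial in commuting indeterminates), $\deg(x^\Lambda)=\sum_t\lambda_t$. $\mathrm{Part}(j)$ is the set of partitions with $\lambda_t=0$ for $t>j$; $\partial_k$ is the partial derivative with respect to $x_k$. Let $\mathcal{B}=\{x^\Lambda\partial_k:1\le k\le n,\ \Lambda\in\mathrm{Part}(k-1)\}$ and let $\mathfrak{L}(n)$ be the free $\mathbb{Z}$-module with basis $\mathcal{B}$, with Lie bracket defined on $\mathcal{B}$ by $[x^\Lambda\partial_k,x^\Theta\partial_u]=\partial_u(x^\Lambda)x^\Theta\partial_k$ if $u<k$, $=-x^\Lambda\partial_k(x^\Theta)\partial_u$ if $u>k$, $=0$ if $u=k$, extended bilinearly. For an integer $i\ge -1$ let $r_i\in\{1,\dots,n-1\}$ with $i\equiv r_i\pmod{n-1}$ and $h_i=\lfloor (i-1)/(n-1)\rfloor+1$. For $x^\Lambda\partial_k\in\mathcal{B}$ define $\mathrm{WD}(x^\Lambda\partial_k)=\mathrm{wt}(\Lambda)-\deg(x^\Lambda)+n-k$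 and $\mathrm{lev}_i(x^\Lambda\partial_k)=h_i\,\mathrm{WD}(x^\Lambda\partial_k)+\deg(x^\Lambda)-1$. For $i\ge -1$ let $\mathcal{N}_i=\{b\in\mathcal{B}: \mathrm{lev}_j(b)\le j \text{ for some integer } j \text{ with } -1\le j\le i\}$. -}

module Defs where

open import Data.Nat as ℕ using (ℕ; zero; suc; _∸_)
import Data.Nat.Properties as ℕP
open import Data.Integer as ℤ using (ℤ; +_; _/ℕ_)
open import Data.List using (List; []; _∷_; length)
open import Data.List.Relation.Unary.All using (All)
import Data.List.Properties as LP
import Data.Product.Properties as PP
open import Data.Product using (_×_; _,_; ∃; ∃-syntax)
open import Relation.Nullary using (yes; no)
open import Relation.Binary.PropositionalEquality using (_≡_)
open import Relation.Binary using (tri<; tri≈; tri>)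
open import Relation.Nullary using (Dec)

-- A monomial vector field x^Λ ∂_k is represented by the pair (k , Λ) where
-- Λ is the list (λ_1 , … , λ_m) of exponents (λ_t = entry at position t-1,
-- missing entries are 0).
Mon : Set
Mon = ℕ × List ℕ

-- (k , Λ) is an element of the basis 𝓑 of 𝔏(n): 1 ≤ k ≤ n and Λ ∈ Part(k-1),
-- stored canonically as a list of length exactly k-1.
IsBasis : ℕ → Mon → Set
IsBasis n (k , Λ) = (1 ℕ.≤ k) × (k ℕ.≤ n) × (length Λ ≡ k ∸ 1)

-- exponent λ_{t+1} (0-indexed position t)
getAt : ℕ → List ℕ → ℕ
getAt _ [] = 0
getAt zero (x ∷ xs) = x
getAt (suc t) (x ∷ xs) = getAt t xs

decAt : ℕ → List ℕ → List ℕ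
decAt _ [] = []
decAt zero (x ∷ xs) = (x ∸ 1) ∷ xs
decAt (suc t) (x ∷ xs) = x ∷ decAt t xs

-- product of monomials: pointwise sum of exponents (padding with zeros)
addL : List ℕ → List ℕ → List ℕ
addL [] ys = ys
addL (x ∷ xs) [] = x ∷ xs
addL (x ∷ xs) (y ∷ ys) = (x ℕ.+ y) ∷ addL xs ys

deg : List ℕ → ℕ
deg [] = 0
deg (x ∷ xs) = x ℕ.+ deg xs

wtFrom : ℕ → List ℕ → ℕ
wtFrom s [] = 0
wtFrom s (x ∷ xs) = s ℕ.* x ℕ.+ wtFrom (suc s) xs

wt : List ℕ → ℕ
wt = wtFrom 1

-- Elements of the free ℤ-module ℤ𝓑 as formal ℤ-linear combinations.
FormalSum : Set
FormalSum = List (ℤ × Mon)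

monDec : (a b : Mon) → Dec (a ≡ b)
monDec = PP.≡-dec ℕP._≟_ (LP.≡-dec ℕP._≟_)

coeff : FormalSum → Mon → ℤ
coeff [] m = + 0
coeff ((c , b) ∷ v) m with monDec b m
... | yes _ = c ℤ.+ coeff v m
... | no  _ = coeff v m

-- Lie bracket of two basis elements:
-- [x^Λ∂_k , x^Θ∂_u] = ∂_u(x^Λ) x^Θ ∂_k  (u<k),  = - x^Λ ∂_k(x^Θ) ∂_u  (u>k),  = 0 (u=k)
-- where ∂_u(x^Λ) = λ_u x^{Λ - e_u}.
-- single term c·b, or 0 if c = 0
term : ℕ → Mon → FormalSum
term zero _ = []
term (suc c) b = ((+ suc c) , b) ∷ []

negTerm : ℕ → Mon → FormalSum
negTerm zero _ = []
negTerm (suc c) b = (ℤ.- (+ suc c) , b) ∷ []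

bracket : Mon → Mon → FormalSum
bracket (k , Λ) (u , Θ) with ℕ.<-cmp u k
... | tri< _ _ _ = term (getAt (u ∸ 1) Λ) (k , addL (decAt (u ∸ 1) Λ) Θ)
... | tri≈ _ _ _ = []
... | tri> _ _ _ = negTerm (getAt (k ∸ 1) Θ) (u , addL Λ (decAt (k ∸ 1) Θ))

-- h_i = ⌊(i-1)/(n-1)⌋ + 1  (for n ≥ 2, suc (n ∸ 2) = n - 1; floor division)
h : ℕ → ℤ → ℤ
h n i = ((i ℤ.- + 1) /ℕ suc (n ∸ 2)) ℤ.+ + 1

WD : ℕ → Mon → ℤ
WD n (k , Λ) = ((+ wt Λ ℤ.- + deg Λ) ℤ.+ + n) ℤ.- + k

lev : ℕ → ℤ → Mon → ℤ
lev n i b@(k , Λ) = (h n i ℤ.* WD n b ℤ.+ + deg Λ) ℤ.- + 1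

𝓝 : ℕ → ℤ → Mon → Set
𝓝 n i b = IsBasis n b × ∃[ j ] ((ℤ.-1ℤ ℤ.≤ j) × (j ℤ.≤ i) × (lev n j b ℤ.≤ j))

InSpan : (Mon → Set) → FormalSum → Set
InSpan S v = ∃[ w ] (All (λ p → S (Data.Product.proj₂ p)) w × (∀ m → coeff v m ≡ coeff w m))

-- Put q = n - 1, W = WD(b) and D = deg(b), so that lev_a(b) = h_a W + D - 1 with
-- h_a = ⌈a / q⌉.  If u < k then [b , b'] is λ_u times the basis element
-- r = x^(Λ - e_u + Θ) ∂_k, and WD(r) = W + W' - q, deg(r) = D + D' - 1; the case
-- u > k is symmetric.  So it suffices to find d ∈ [-1 , j - 1] with lev_d(r) ≤ d,
-- given lev_a(b) ≤ a ≤ i < j and lev_c(b') ≤ c ≤ j.  If c ≤ a take d = a: as h is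
-- monotone and W' ≤ q, the excess h_a (W' - q) + D' - 1 is at most
-- h_c (W' - q) + D' - 1 ≤ c - h_c q ≤ 0.  If a < c take d = c - 1, comparing
-- h_{c-1} with h_a and h_c.  Everything rests on the constraints W ≥ 0, W ≤ q if
-- D = 0, and W ≤ (q - 1) D otherwise, which every basis element satisfies.

module Submission where

open import Defs
open import Data.Empty using (⊥; ⊥-elim)
import Data.Integer
open import Data.Integer as ℤ
  using (ℤ; +_; -[1+_]; _+_; _*_; _-_; -_; _≤_; _<_; 0ℤ; -1ℤ; +≤+; -≤-; -≤+; _/ℕ_; _%ℕ_)
open import Data.Integer.DivMod using (a≡a%ℕn+[a/ℕn]*n; n%ℕd<d)
import Data.Integer.Properties as ℤP
open import Data.Integer.Tactic.RingSolver using (solve-∀)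
open import Data.List using (List; []; _∷_; length)
open import Data.List.Relation.Unary.All using ([]; _∷_)
open import Data.Nat as ℕ using (ℕ; zero; suc; z≤n; s≤s; _∸_)
import Data.Nat.Properties as ℕP
open import Algebra.Properties.CommutativeSemigroup ℕP.+-commutativeSemigroup
  using () renaming (xy∙z≈xz∙y to +-right-comm)
open import Data.Nat.Tactic.RingSolver using () renaming (solve-∀ to ℕsolve-∀)
open import Data.Product using (_×_; _,_; ∃-syntax; proj₁; proj₂)
open import Data.Sum using (_⊎_; inj₁; inj₂)
open import Function using (_∘_)
open import Relation.Binary using (tri<; tri≈; tri>)
open import Relation.Binary.PropositionalEquality
open import Relation.Nullary using (Dec; yes; no)

infixl 6 _⊕_
infixl 7 _⊗_

-- Inequalities are proved by certificates: y - x is a sum of products of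
-- manifestly non-negative terms, the identity being checked by the ring solver.

gap : ∀ {x y} → x ≤ y → 0ℤ ≤ y - x
gap = ℤP.i≤j⇒0≤j-i

0≤+ : ∀ n → 0ℤ ≤ + n
0≤+ _ = +≤+ z≤n

_⊕_ : ∀ {x y} → 0ℤ ≤ x → 0ℤ ≤ y → 0ℤ ≤ x + y
_⊕_ = ℤP.+-mono-≤

_⊗_ : ∀ {x y} → 0ℤ ≤ x → 0ℤ ≤ y → 0ℤ ≤ x * y
_⊗_ {+ m} {+ k} _ _ = subst (0ℤ ≤_) (ℤP.pos-* m k) (0≤+ (m ℕ.* k))

-- Opaque, so that Agda never unfolds a ring-solver proof while reducing a clause body.
opaque
  ≤-by-certificate : ∀ {s x y} → 0ℤ ≤ s → s ≡ y - x → x ≤ y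
  ≤-by-certificate 0≤s refl = ℤP.0≤i-j⇒j≤i 0≤s

  ⊥-by-certificate : ∀ {s k} → 0ℤ ≤ s → s ≡ -[1+ k ] → ⊥
  ⊥-by-certificate () refl

<⇒≤-1 : ∀ {x y} → x < y → x ≤ y - + 1
<⇒≤-1 {x} {y} x<y = subst (x ≤_) (ℤP.+-comm -1ℤ y) (ℤP.i<j⇒i≤pred[j] x<y)

-- h n x is the ceiling of x / (n - 1), as the next two lemmas show.

module _ (n : ℕ) (x : ℤ) where
  private
    q r : ℕ
    q = suc (n ∸ 2)
    r = (x - + 1) %ℕ q
    Q : ℤ
    Q = (x - + 1) /ℕ q

  h-upper : x ≤ h n x * + q
  h-upper = ≤-by-certificate (gap (ℤP.i<j⇒suc[i]≤j (ℤ.+<+ (n%ℕd<d (x - + 1) q)))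
                               ⊕ gap (ℤP.≤-reflexive (a≡a%ℕn+[a/ℕn]*n (x - + 1) q)))
                             (certificate x (+ r) Q (+ q))
    where
    certificate : ∀ x r Q q → (q - (+ 1 + r)) + ((r + Q * q) - (x - + 1)) ≡ (Q + + 1) * q - x
    certificate = solve-∀

  h-lower : h n x * + q - + q + + 1 ≤ x
  h-lower = ≤-by-certificate (0≤+ r ⊕ gap (ℤP.≤-reflexive (sym (a≡a%ℕn+[a/ℕn]*n (x - + 1) q))))
                             (certificate x (+ r) Q (+ q))
    where
    certificate : ∀ x r Q q → r + ((x - + 1) - (r + Q * q)) ≡ x - ((Q + + 1) * q - q + + 1)
    certificate = solve-∀

-- The constraints that (WD b , deg b) satisfies for every basis element b of 𝔏(q + 1).
record Admissible (q W D : ℤ) : Set where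
  field
    0≤W      : 0ℤ ≤ W
    0≤D      : 0ℤ ≤ D
    W≤q      : D ≡ 0ℤ → W ≤ q
    W≤[q-1]D : + 1 ≤ D → W ≤ (q - + 1) * D

module CeilingLevels (q : ℤ) (H : ℤ → ℤ) (1≤q : + 1 ≤ q)
  (H-upper : ∀ x → x ≤ H x * q) (H-lower : ∀ x → H x * q - q + + 1 ≤ x) where

  Below : ℤ → ℤ → ℤ → Set
  Below a W D = H a * W + D - + 1 ≤ a

  0≤q : 0ℤ ≤ q
  0≤q = ℤP.≤-trans (0≤+ 1) 1≤q

  H-mono : ∀ {x y} → x ≤ y → H x ≤ H y
  H-mono {x} {y} x≤y with H x ℤP.≤? H y
  ... | yes Hx≤Hy = Hx≤Hy
  ... | no Hx≰Hy = ⊥-elim (⊥-by-certificate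
          (gap (H-upper y) ⊕ gap (H-lower x) ⊕ gap x≤y
            ⊕ gap (ℤP.i<j⇒suc[i]≤j (ℤP.≰⇒> Hx≰Hy)) ⊗ 0≤q)
          (certificate q (H x) (H y) x y))
    where
    certificate : ∀ q hx hy x y →
      (hy * q - y) + (x - (hx * q - q + + 1)) + (y - x) + (hx - (+ 1 + hy)) * q ≡ -1ℤ
    certificate = solve-∀

  H-≥-1 : ∀ {x} → -1ℤ ≤ x → -1ℤ ≤ H x
  H-≥-1 {x} -1≤x = factor-≥-1 (H x) (ℤP.≤-trans -1≤x (H-upper x))
    where
    factor-≥-1 : ∀ y → -1ℤ ≤ y * q → -1ℤ ≤ y
    factor-≥-1 (+ _)        _    = -≤+
    factor-≥-1 y@(-[1+ k ]) -1≤yq =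
      ℤP.≤-trans -1≤yq (≤-by-certificate (0≤+ (suc k) ⊗ gap 1≤q) (certificate y q))
      where
      certificate : ∀ y q → (- y) * (q - + 1) ≡ y - y * q
      certificate = solve-∀

  module _ {a W D : ℤ} (A : Admissible q W D) (-1≤a : -1ℤ ≤ a) (below : Below a W D) where
    open Admissible A

    weight-<-of-positive-degree : + 1 ≤ D → W < q
    weight-<-of-positive-degree 1≤D =
      ℤP.suc[i]≤j⇒i<j (by-ceiling (H a) D (H-upper a) (H-≥-1 -1≤a) below (W≤[q-1]D 1≤D) 1≤D)
      where
      by-ceiling : ∀ t e → a ≤ t * q → -1ℤ ≤ t → t * W + e - + 1 ≤ a → W ≤ (q - + 1) * e → + 1 ≤ e
              → + 1 + W ≤ q
      by-ceiling -[1+ 0 ] e a≤-q _ _ W≤ 1≤e =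
        ≤-by-certificate (gap W≤ ⊕ (gap a≤-q ⊕ gap -1≤a) ⊗ gap 1≤e) (certificate q W a e)
        where
        certificate : ∀ q W a e →
          ((q - + 1) * e - W) + ((-1ℤ * q - a) + (a - -1ℤ)) * (e - + 1) ≡ q - (+ 1 + W)
        certificate = solve-∀
      by-ceiling -[1+ suc _ ] _ _ (-≤- ()) _ _ _
      by-ceiling _ (+ 0) _ _ _ _ (+≤+ ())
      by-ceiling t (+ 1) _ _ _ W≤ _ = ≤-by-certificate (gap W≤) (certificate q W)
        where
        certificate : ∀ q W → (q - + 1) * + 1 - W ≡ q - (+ 1 + W)
        certificate = solve-∀
      by-ceiling (+ 0) e@(+ suc (suc _)) a≤0 _ below′ _ _ =
        ⊥-elim (⊥-by-certificate (gap a≤0 ⊕ gap below′) (certificate q W a e))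
        where
        certificate : ∀ q W a e → (+ 0 * q - a) + (a - (+ 0 * W + e - + 1)) ≡ + 1 - e
        certificate = solve-∀
      by-ceiling t@(+ suc k) e@(+ suc (suc _)) a≤tq _ below′ _ _ with (+ 1 + W) ℤP.≤? q
      ... | yes 1+W≤q = 1+W≤q
      ... | no 1+W≰q = ⊥-elim (⊥-by-certificate
              (gap a≤tq ⊕ gap below′ ⊕ 0≤+ (suc k) ⊗ gap (ℤP.i<j⇒suc[i]≤j (ℤP.≰⇒> 1+W≰q)))
              (certificate q W a e t))
        where
        certificate : ∀ q W a e t →
          (t * q - a) + (a - (t * W + e - + 1)) + t * ((+ 1 + W) - (+ 1 + q)) ≡ + 1 - e
        certificate = solve-∀

    weight-cases : (D ≡ 0ℤ × W ≤ q) ⊎ W < q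
    weight-cases with D ℤP.≟ 0ℤ
    ... | yes D≡0 = inj₁ (D≡0 , W≤q D≡0)
    ... | no D≢0  = inj₂ (weight-<-of-positive-degree (ℤP.i<j⇒suc[i]≤j (ℤP.≤∧≢⇒< 0≤D (D≢0 ∘ sym))))

    weight-≤ : W ≤ q
    weight-≤ with weight-cases
    ... | inj₁ (_ , W≤q′) = W≤q′
    ... | inj₂ W<q       = ℤP.<⇒≤ W<q

    above-ceiling : ∀ {t} → H a < t → t * W + D ≤ t * q
    above-ceiling {t} Ha<t = by-cases weight-cases
      where
      1+Ha≤t : + 1 + H a ≤ t
      1+Ha≤t = ℤP.i<j⇒suc[i]≤j Ha<t
      by-cases : (D ≡ 0ℤ × W ≤ q) ⊎ W < q → t * W + D ≤ t * q
      by-cases (inj₁ (D≡0 , W≤q′)) =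
        ≤-by-certificate ((gap 1+Ha≤t ⊕ gap (H-≥-1 -1≤a)) ⊗ gap W≤q′ ⊕ gap (ℤP.≤-reflexive D≡0))
                         (certificate q W D t (H a))
        where
        certificate : ∀ q W D t ha →
          ((t - (+ 1 + ha)) + (ha - -1ℤ)) * (q - W) + (0ℤ - D) ≡ t * q - (t * W + D)
        certificate = solve-∀
      by-cases (inj₂ W<q) =
        ≤-by-certificate (gap (H-upper a) ⊕ gap below ⊕ gap 1+Ha≤t ⊗ gap (ℤP.<⇒≤ W<q)
                          ⊕ gap (ℤP.i<j⇒suc[i]≤j W<q))
                         (certificate q W D a t (H a))
        where
        certificate : ∀ q W D a t ha →
          (ha * q - a) + (a - (ha * W + D - + 1)) + (t - (+ 1 + ha)) * (q - W) + (q - (+ 1 + W))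
            ≡ t * q - (t * W + D)
        certificate = solve-∀

  open Admissible

  -- With t = H (c - 1) ≤ s = H c, this turns lev_c(b') ≤ c into lev_{c-1}(r) ≤ c - 1.
  pred-ceiling-bound : ∀ {a c W D W'} → Admissible q W D → 0ℤ ≤ W' → 0ℤ ≤ W + W' - q
    → -1ℤ ≤ a → a < c → Below a W D
    → H (c - + 1) * W + D ≤ H (c - + 1) * q + (H c - H (c - + 1)) * W'
  pred-ceiling-bound {a} {c} {W} {D} {W'} A 0≤W' 0≤W+W'-q -1≤a a<c below =
    by-comparison (H a ℤP.<? t) (t ℤP.<? s)
    where
    t s : ℤ
    t = H (c - + 1)
    s = H c
    a≤c-1 : a ≤ c - + 1
    a≤c-1 = <⇒≤-1 a<c
    t≤s : t ≤ s
    t≤s = H-mono (ℤP.i-j≤i c (+ 1))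
    -- If H a < t then b already fits at level t; otherwise H a = t, so lev_t(b) ≤ a < c.
    by-comparison : Dec (H a < t) → Dec (t < s) → t * W + D ≤ t * q + (s - t) * W'
    by-comparison (yes Ha<t) _ =
      ≤-by-certificate (gap (above-ceiling A -1≤a below Ha<t) ⊕ gap t≤s ⊗ 0≤W')
                       (certificate q W D W' t s)
      where
      certificate : ∀ q W D W' t s →
        (t * q - (t * W + D)) + (s - t) * W' ≡ (t * q + (s - t) * W') - (t * W + D)
      certificate = solve-∀
    by-comparison (no Ha≮t) (no t≮s) =
      ≤-by-certificate (gap below ⊕ gap (ℤP.≮⇒≥ Ha≮t) ⊗ 0≤W A ⊕ gap a≤c-1 ⊕ gap (H-upper c)
                        ⊕ gap (ℤP.≮⇒≥ t≮s) ⊗ 0≤q ⊕ gap t≤s ⊗ 0≤W')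
                       (certificate q W D W' a c t s (H a))
      where
      certificate : ∀ q W D W' a c t s ha →
        (a - (ha * W + D - + 1)) + (ha - t) * W + ((c - + 1) - a) + (s * q - c) + (t - s) * q + (s - t) * W'
          ≡ (t * q + (s - t) * W') - (t * W + D)
      certificate = solve-∀
    by-comparison (no Ha≮t) (yes t<s) = by-weight (weight-cases A -1≤a below)
      where
      by-weight : (D ≡ 0ℤ × W ≤ q) ⊎ W < q → t * W + D ≤ t * q + (s - t) * W'
      by-weight (inj₁ (D≡0 , W≤q′)) =
        ≤-by-certificate (gap (H-≥-1 (ℤP.≤-trans -1≤a a≤c-1)) ⊗ gap W≤q′ ⊕ 0≤W+W'-q
                          ⊕ gap (ℤP.i<j⇒suc[i]≤j t<s) ⊗ 0≤W' ⊕ gap (ℤP.≤-reflexive D≡0))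
                         (certificate q W D W' t s)
        where
        certificate : ∀ q W D W' t s →
          (t - -1ℤ) * (q - W) + (W + W' - q) + (s - (+ 1 + t)) * W' + (0ℤ - D)
            ≡ (t * q + (s - t) * W') - (t * W + D)
        certificate = solve-∀
      by-weight (inj₂ W<q) =
        ≤-by-certificate (gap below ⊕ gap (ℤP.≮⇒≥ Ha≮t) ⊗ 0≤W A ⊕ gap a≤c-1 ⊕ gap (H-upper (c - + 1))
                          ⊕ 0≤W+W'-q ⊕ gap (ℤP.i<j⇒suc[i]≤j W<q)
                          ⊕ gap (ℤP.i<j⇒suc[i]≤j t<s) ⊗ 0≤W')
                         (certificate q W D W' a c t s (H a))
        where
        certificate : ∀ q W D W' a c t s ha →
          (a - (ha * W + D - + 1)) + (ha - t) * W + ((c - + 1) - a) + (t * q - (c - + 1))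
            + (W + W' - q) + (q - (+ 1 + W)) + (s - (+ 1 + t)) * W'
            ≡ (t * q + (s - t) * W') - (t * W + D)
        certificate = solve-∀

  module _ {a c W D W' D' : ℤ} (A : Admissible q W D) (A′ : Admissible q W' D')
    (-1≤a : -1ℤ ≤ a) (below : Below a W D) (-1≤c : -1ℤ ≤ c) (below′ : Below c W' D') where

    product-below-≥ : c ≤ a → Below a (W + W' - q) (D + D' - + 1)
    product-below-≥ c≤a =
      ≤-by-certificate (gap below ⊕ gap below′ ⊕ gap (H-upper c)
                        ⊕ gap (H-mono c≤a) ⊗ gap (weight-≤ A′ -1≤c below′))
                       (certificate q W D W' D' a c (H a) (H c))
      where
      certificate : ∀ q W D W' D' a c ha hc →
        (a - (ha * W + D - + 1)) + (c - (hc * W' + D' - + 1)) + (hc * q - c) + (ha - hc) * (q - W')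
          ≡ a - (ha * (W + W' - q) + (D + D' - + 1) - + 1)
      certificate = solve-∀

    product-below-< : 0ℤ ≤ W + W' - q → a < c → Below (c - + 1) (W + W' - q) (D + D' - + 1)
    product-below-< 0≤W+W'-q a<c =
      ≤-by-certificate (gap below′ ⊕ gap (pred-ceiling-bound A (0≤W A′) 0≤W+W'-q -1≤a a<c below))
                       (certificate q W D W' D' c (H (c - + 1)) (H c))
      where
      certificate : ∀ q W D W' D' c t s →
        (c - (s * W' + D' - + 1)) + ((t * q + (s - t) * W') - (t * W + D))
          ≡ (c - + 1) - (t * (W + W' - q) + (D + D' - + 1) - + 1)
      certificate = solve-∀

    product-level : ∀ {j Wr Dr} → Wr ≡ W + W' - q → Dr ≡ D + D' - + 1 → 0ℤ ≤ Wr → a < j → c ≤ j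
      → ∃[ d ] (-1ℤ ≤ d × d ≤ j - + 1 × Below d Wr Dr)
    product-level refl refl 0≤Wr a<j c≤j with c ℤP.≤? a
    ... | yes c≤a = a , -1≤a , <⇒≤-1 a<j , product-below-≥ c≤a
    ... | no c≰a  = c - + 1 , ℤP.≤-trans -1≤a (<⇒≤-1 (ℤP.≰⇒> c≰a)) , ℤP.+-monoˡ-≤ (- + 1) c≤j ,
                    product-below-< 0≤Wr (ℤP.≰⇒> c≰a)

addL-comm : ∀ xs ys → addL xs ys ≡ addL ys xs
addL-comm []       []       = refl
addL-comm []       (_ ∷ _)  = refl
addL-comm (_ ∷ _)  []       = refl
addL-comm (x ∷ xs) (y ∷ ys) = cong₂ _∷_ (ℕP.+-comm x y) (addL-comm xs ys)

length-addL : ∀ xs ys → length ys ℕ.≤ length xs → length (addL xs ys) ≡ length xs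
length-addL []       []       _         = refl
length-addL (_ ∷ _)  []       _         = refl
length-addL (_ ∷ xs) (_ ∷ ys) (s≤s |ys|≤|xs|) = cong suc (length-addL xs ys |ys|≤|xs|)

length-decAt : ∀ t xs → length (decAt t xs) ≡ length xs
length-decAt _       []       = refl
length-decAt zero    (_ ∷ _)  = refl
length-decAt (suc t) (_ ∷ xs) = cong suc (length-decAt t xs)

deg-addL : ∀ xs ys → deg (addL xs ys) ≡ deg xs ℕ.+ deg ys
deg-addL []       _        = refl
deg-addL (_ ∷ _)  []       = sym (ℕP.+-identityʳ _)
deg-addL (x ∷ xs) (y ∷ ys) rewrite deg-addL xs ys = rearrange x y (deg xs) (deg ys)
  where
  rearrange : ∀ a b c d → a ℕ.+ b ℕ.+ (c ℕ.+ d) ≡ a ℕ.+ c ℕ.+ (b ℕ.+ d)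
  rearrange = ℕsolve-∀

wtFrom-addL : ∀ s xs ys → wtFrom s (addL xs ys) ≡ wtFrom s xs ℕ.+ wtFrom s ys
wtFrom-addL _ []       _        = refl
wtFrom-addL _ (_ ∷ _)  []       = sym (ℕP.+-identityʳ _)
wtFrom-addL s (x ∷ xs) (y ∷ ys) rewrite wtFrom-addL (suc s) xs ys =
  rearrange s x y (wtFrom (suc s) xs) (wtFrom (suc s) ys)
  where
  rearrange : ∀ s a b c d → s ℕ.* (a ℕ.+ b) ℕ.+ (c ℕ.+ d) ≡ s ℕ.* a ℕ.+ c ℕ.+ (s ℕ.* b ℕ.+ d)
  rearrange = ℕsolve-∀

deg-decAt : ∀ t xs → 1 ℕ.≤ getAt t xs → deg (decAt t xs) ℕ.+ 1 ≡ deg xs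
deg-decAt zero    (suc x ∷ xs) _   = ℕP.+-comm (x ℕ.+ deg xs) 1
deg-decAt (suc t) (x ∷ xs)     1≤λ =
  trans (ℕP.+-assoc x (deg (decAt t xs)) 1) (cong (x ℕ.+_) (deg-decAt t xs 1≤λ))

wtFrom-decAt : ∀ s t xs → 1 ℕ.≤ getAt t xs → wtFrom s (decAt t xs) ℕ.+ (s ℕ.+ t) ≡ wtFrom s xs
wtFrom-decAt s zero (suc x ∷ xs) _ = rearrange s x (wtFrom (suc s) xs)
  where
  rearrange : ∀ s x w → s ℕ.* x ℕ.+ w ℕ.+ (s ℕ.+ 0) ≡ s ℕ.* (1 ℕ.+ x) ℕ.+ w
  rearrange = ℕsolve-∀
wtFrom-decAt s (suc t) (x ∷ xs) 1≤λ = begin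
  s ℕ.* x ℕ.+ w ℕ.+ (s ℕ.+ suc t)   ≡⟨ cong (s ℕ.* x ℕ.+ w ℕ.+_) (ℕP.+-suc s t) ⟩
  s ℕ.* x ℕ.+ w ℕ.+ (suc s ℕ.+ t)   ≡⟨ ℕP.+-assoc (s ℕ.* x) w (suc s ℕ.+ t) ⟩
  s ℕ.* x ℕ.+ (w ℕ.+ (suc s ℕ.+ t)) ≡⟨ cong (s ℕ.* x ℕ.+_) (wtFrom-decAt (suc s) t xs 1≤λ) ⟩
  s ℕ.* x ℕ.+ wtFrom (suc s) xs     ∎
  where
  open ≡-Reasoning
  w : ℕ
  w = wtFrom (suc s) (decAt t xs)

wtFrom-suc : ∀ s xs → wtFrom (suc s) xs ≡ deg xs ℕ.+ wtFrom s xs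
wtFrom-suc s []       = refl
wtFrom-suc s (x ∷ xs) rewrite wtFrom-suc (suc s) xs = rearrange s x (deg xs) (wtFrom (suc s) xs)
  where
  rearrange : ∀ s x d w → suc s ℕ.* x ℕ.+ (d ℕ.+ w) ≡ x ℕ.+ d ℕ.+ (s ℕ.* x ℕ.+ w)
  rearrange = ℕsolve-∀

deg≤wt : ∀ xs → deg xs ℕ.≤ wt xs
deg≤wt xs = subst (deg xs ℕ.≤_) (sym (wtFrom-suc 0 xs)) (ℕP.m≤m+n (deg xs) (wtFrom 0 xs))

wtFrom≤ : ∀ s xs → wtFrom (suc s) xs ℕ.≤ (s ℕ.+ length xs) ℕ.* deg xs
wtFrom≤ s []       = z≤n
wtFrom≤ s (x ∷ xs) = begin
  suc s ℕ.* x ℕ.+ wtFrom (suc (suc s)) xs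
    ≤⟨ ℕP.+-monoʳ-≤ (suc s ℕ.* x) (wtFrom≤ (suc s) xs) ⟩
  suc s ℕ.* x ℕ.+ (suc s ℕ.+ length xs) ℕ.* deg xs
    ≤⟨ ℕP.+-monoˡ-≤ _ (ℕP.*-monoˡ-≤ x (s≤s (ℕP.m≤m+n s (length xs)))) ⟩
  (suc s ℕ.+ length xs) ℕ.* x ℕ.+ (suc s ℕ.+ length xs) ℕ.* deg xs
    ≡⟨ rearrange s (length xs) x (deg xs) ⟩
  (s ℕ.+ suc (length xs)) ℕ.* (x ℕ.+ deg xs)
    ∎
  where
  open ℕP.≤-Reasoning
  rearrange : ∀ s l x d → (suc s ℕ.+ l) ℕ.* x ℕ.+ (suc s ℕ.+ l) ℕ.* d ≡ (s ℕ.+ suc l) ℕ.* (x ℕ.+ d)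
  rearrange = ℕsolve-∀

basis-admissible : ∀ {n} b → IsBasis n b → Admissible (+ n - + 1) (WD n b) (+ deg (proj₂ b))
basis-admissible {n} (suc k , Λ) (_ , k<n , |Λ|≡k) = record
  { 0≤W      = ≤-by-certificate (gap (+≤+ (deg≤wt Λ)) ⊕ gap (+≤+ k<n))
                                (nonneg-certificate (+ wt Λ) (+ deg Λ) (+ n) (+ suc k))
  ; 0≤D      = 0≤+ (deg Λ)
  ; W≤q      = λ deg≡0 → WD≤q (ℤP.+-injective deg≡0)
  ; W≤[q-1]D = λ 1≤deg → ≤-by-certificate (gap wt≤k*deg ⊕ gap (+≤+ k<n) ⊗ gap 1≤deg)
                                         (bound-certificate (+ wt Λ) (+ deg Λ) (+ n) (+ k))
  }
  where
  nonneg-certificate : ∀ w d n k → (w - d) + (n - k) ≡ ((w - d) + n - k) - 0ℤ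
  nonneg-certificate = solve-∀
  wt≤kdeg : wt Λ ℕ.≤ k ℕ.* deg Λ
  wt≤kdeg = subst (λ l → wt Λ ℕ.≤ l ℕ.* deg Λ) |Λ|≡k (wtFrom≤ 0 Λ)
  wt≤k*deg : + wt Λ ≤ + k * + deg Λ
  wt≤k*deg = subst (+ wt Λ ≤_) (ℤP.pos-* k (deg Λ)) (+≤+ wt≤kdeg)
  bound-certificate : ∀ w d n k →
    (k * d - w) + (n - (+ 1 + k)) * (d - + 1) ≡ (n - + 1 - + 1) * d - ((w - d) + n - (+ 1 + k))
  bound-certificate = solve-∀
  wt≡0 : deg Λ ≡ 0 → wt Λ ≡ 0
  wt≡0 deg≡0 =
    ℕP.n≤0⇒n≡0 (ℕP.≤-trans wt≤kdeg (ℕP.≤-reflexive (trans (cong (k ℕ.*_) deg≡0) (ℕP.*-zeroʳ k))))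
  WD≤q : deg Λ ≡ 0 → WD n (suc k , Λ) ≤ + n - + 1
  WD≤q deg≡0 rewrite deg≡0 | wt≡0 deg≡0 =
    ≤-by-certificate (0≤+ k) (certificate (+ n) (+ k))
    where
    certificate : ∀ n k → k ≡ (n - + 1) - ((+ 0 - + 0) + n - (+ 1 + k))
    certificate = solve-∀

-- r is the (non-zero) basis element carried by the bracket of b and b'.
record IsProduct (n : ℕ) (b b' r : Mon) : Set where
  field
    basis   : IsBasis n r
    WD-sum  : WD n r ≡ WD n b + WD n b' - (+ n - + 1)
    deg-sum : + deg (proj₂ r) ≡ + deg (proj₂ b) + + deg (proj₂ b') - + 1

IsProduct-sym : ∀ {n b b' r} → IsProduct n b b' r → IsProduct n b' b r
IsProduct-sym {n} {b} {b'} P = record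
  { basis   = basis
  ; WD-sum  = trans WD-sum (cong (_- (+ n - + 1)) (ℤP.+-comm (WD n b) (WD n b')))
  ; deg-sum = trans deg-sum (cong (_- + 1) (ℤP.+-comm (+ deg (proj₂ b)) (+ deg (proj₂ b'))))
  }
  where open IsProduct P

pos-≡-sub : ∀ {x y} a b → x ℕ.+ y ≡ a ℕ.+ b → + x ≡ + a + + b - + y
pos-≡-sub {x} {y} _ _ x+y≡a+b = trans (certificate (+ x) (+ y)) (cong (λ z → + z - + y) x+y≡a+b)
  where
  certificate : ∀ x y → x ≡ x + y - y
  certificate = solve-∀

WD-of-product : ∀ n k u wl dl wt dt wr dr → wr ≡ wl + wt - u → dr ≡ dl + dt - + 1
  → wr - dr + n - k ≡ (wl - dl + n - k) + (wt - dt + n - u) - (n - + 1)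
WD-of-product n k u wl dl wt dt _ _ refl refl = certificate n k u wl dl wt dt
  where
  certificate : ∀ n k u wl dl wt dt →
    (wl + wt - u) - (dl + dt - + 1) + n - k ≡ (wl - dl + n - k) + (wt - dt + n - u) - (n - + 1)
  certificate = solve-∀

derivative-product : ∀ {n k u Λ Θ} → IsBasis n (k , Λ) → IsBasis n (u , Θ) → u ℕ.< k
  → 1 ℕ.≤ getAt (u ∸ 1) Λ → IsProduct n (k , Λ) (u , Θ) (k , addL (decAt (u ∸ 1) Λ) Θ)
derivative-product {n} {suc k} {suc u} {Λ} {Θ} (1≤k , k≤n , |Λ|≡k) (_ , _ , |Θ|≡u) (s≤s u<k) 1≤λ = record
  { basis   = 1≤k , k≤n , trans (length-addL (decAt u Λ) Θ |Θ|≤|Λ-e|) (trans (length-decAt u Λ) |Λ|≡k)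
  ; WD-sum  = WD-of-product (+ n) (+ suc k) (+ suc u) (+ wt Λ) (+ deg Λ) (+ wt Θ) (+ deg Θ) _ _
                (pos-≡-sub (wt Λ) (wt Θ) wt-sum) deg-sum
  ; deg-sum = deg-sum
  }
  where
  r : List ℕ
  r = addL (decAt u Λ) Θ
  |Θ|≤|Λ-e| : length Θ ℕ.≤ length (decAt u Λ)
  |Θ|≤|Λ-e| rewrite length-decAt u Λ | |Λ|≡k | |Θ|≡u = ℕP.<⇒≤ u<k
  deg-sum : + deg r ≡ + deg Λ + + deg Θ - + 1
  deg-sum = pos-≡-sub (deg Λ) (deg Θ) (begin
    deg r ℕ.+ 1                          ≡⟨ cong (ℕ._+ 1) (deg-addL (decAt u Λ) Θ) ⟩
    deg (decAt u Λ) ℕ.+ deg Θ ℕ.+ 1      ≡⟨ +-right-comm (deg (decAt u Λ)) (deg Θ) 1 ⟩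
    deg (decAt u Λ) ℕ.+ 1 ℕ.+ deg Θ      ≡⟨ cong (ℕ._+ deg Θ) (deg-decAt u Λ 1≤λ) ⟩
    deg Λ ℕ.+ deg Θ                      ∎)
    where open ≡-Reasoning
  wt-sum : wt r ℕ.+ suc u ≡ wt Λ ℕ.+ wt Θ
  wt-sum = begin
    wt r ℕ.+ suc u                       ≡⟨ cong (ℕ._+ suc u) (wtFrom-addL 1 (decAt u Λ) Θ) ⟩
    wt (decAt u Λ) ℕ.+ wt Θ ℕ.+ suc u    ≡⟨ +-right-comm (wt (decAt u Λ)) (wt Θ) (suc u) ⟩
    wt (decAt u Λ) ℕ.+ suc u ℕ.+ wt Θ    ≡⟨ cong (ℕ._+ wt Θ) (wtFrom-decAt 1 u Λ 1≤λ) ⟩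
    wt Λ ℕ.+ wt Θ                        ∎
    where open ≡-Reasoning

product-∈𝓝 : ∀ {m i j b b' r} → let n = suc (suc m) in
  i < j → IsProduct n b b' r → 𝓝 n i b → 𝓝 n j b' → 𝓝 n (j - + 1) r
product-∈𝓝 {m} {b = b@(_ , _)} {b'@(_ , _)} {r@(_ , _)} i<j P
  (basis-b , a , -1≤a , a≤i , below) (basis-b' , c , -1≤c , c≤j , below′) =
  basis , product-level (basis-admissible b basis-b) (basis-admissible b' basis-b') -1≤a below -1≤c below′
            WD-sum deg-sum (Admissible.0≤W (basis-admissible r basis)) (ℤP.≤-<-trans a≤i i<j) c≤j
  where
  open IsProduct P
  open CeilingLevels (+ suc m) (h (suc (suc m))) (+≤+ (s≤s z≤n)) (h-upper (suc (suc m))) (h-lower (suc (suc m)))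

InSpan-term : ∀ S c b → (1 ℕ.≤ c → S b) → InSpan S (term c b)
InSpan-term S zero    b _   = [] , [] , λ _ → refl
InSpan-term S (suc c) b S-b = (+ suc c , b) ∷ [] , S-b (s≤s z≤n) ∷ [] , λ _ → refl

InSpan-negTerm : ∀ S c b → (1 ℕ.≤ c → S b) → InSpan S (negTerm c b)
InSpan-negTerm S zero    b _   = [] , [] , λ _ → refl
InSpan-negTerm S (suc c) b S-b = (- + suc c , b) ∷ [] , S-b (s≤s z≤n) ∷ [] , λ _ → refl

lemma3p1 : (n : ℕ) → 2 ℕ.≤ n → (i j : ℤ) → -1ℤ Data.Integer.≤ i → i < j →
    (b b' : Mon) → 𝓝 n i b → 𝓝 n j b' → InSpan (𝓝 n (j - + 1)) (bracket b b')
lemma3p1 (suc zero) (s≤s ()) _ _ _ _ _ _ _ _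
lemma3p1 (suc (suc m)) _ i j _ i<j b@(k , Λ) b'@(u , Θ) b∈𝓝 b'∈𝓝 with ℕ.<-cmp u k
... | tri< u<k _ _ = InSpan-term _ (getAt (u ∸ 1) Λ) (k , addL (decAt (u ∸ 1) Λ) Θ) λ 1≤λ →
  product-∈𝓝 i<j (derivative-product {Λ = Λ} {Θ = Θ} (proj₁ b∈𝓝) (proj₁ b'∈𝓝) u<k 1≤λ)
             b∈𝓝 b'∈𝓝
... | tri≈ _ _ _   = [] , [] , λ _ → refl
... | tri> _ _ k<u = InSpan-negTerm _ (getAt (k ∸ 1) Θ) (u , addL Λ (decAt (k ∸ 1) Θ)) λ 1≤θ →
  product-∈𝓝 i<j (subst (IsProduct _ b b') (cong (u ,_) (addL-comm (decAt (k ∸ 1) Θ) Λ))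
                    (IsProduct-sym
                      (derivative-product {Λ = Θ} {Θ = Λ} (proj₁ b'∈𝓝) (proj₁ b∈𝓝) k<u 1≤θ)))
             b∈𝓝 b'∈𝓝
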